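{- Let $\mathcal{I}^A,\mathcal{I}^B$ be instances on the same graph that differ only in the preference order of agent $x$, and let $M$ be a matching that leaves $x$ unmatched. Then (1) $M$ is popular for $\mathcal{I}^A$ if and only if $M$ is popular for $\mathcal{I}^B$, and (2) $M$ is dominant for $\mathcal{I}^A$ if and only if $M$ is dominant for $\mathcal{I}^B$.
   Context: An instance $\mathcal{I}$ of matchings under preferences consists of a finite bipartite graph $(W\cup F,E)$ and, for every agent $z$, a strict linear order $\succ_z^{\mathcal{I}}$ over its neighbour set. A matching is a set of pairwise disjoint edges; $M(z)$ is the partner of matched $z$. Agent $z$ prefers $M$ over $M'$ if $z$ is matched in $M$ and unmatched in $M'$, or matched in both and $M(z)\succ_z M'(z)$; $\mathrm{vote}_z(M,M')$ is $1$, $-1$, $0$ accordingly, and $\Delta^{\mathcal{I}}(M,M')=\sum_z\mathrm{vote}_z(M,M')$. $M$ is popular if $\Delta^{\mathcal{I}}(M,M')\ge 0$ for all matchings $M'$, dominant if popular and $\Delta^{\mathcal{I}}(M,M')>0$ for all $M'$ with $|M'|>|M|$. -}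

module Defs where

open import Data.Nat using (ℕ; _<_)
open import Data.Fin using (Fin)
open import Data.List using (List; map; foldr)
open import Data.List.Base using (allFin)
open import Data.Bool using (Bool; true; false; if_then_else_)
open import Data.Maybe using (Maybe; just; nothing)
open import Data.Integer using (ℤ; +_; -_; _+_; _≥_; _>_)
open import Data.Sum using (_⊎_; inj₁; inj₂)
open import Data.Product using (_×_)
open import Relation.Binary.PropositionalEquality using (_≡_; _≢_)
open import Relation.Nullary using (¬_)

record Graph : Set where
  field
    nW  : ℕ
    nF  : ℕ
    adj : Fin nW → Fin nF → Bool
open Graph public

Agent : Graph → Set
Agent G = Fin (nW G) ⊎ Fin (nF G)

-- A strict linear order on the neighbour set  { b | nb b ≡ true }  of an agent,
-- given as a decidable relation  pref a b  ("a is preferred to b").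
record StrictLinearOn {A : Set} (nb : A → Bool) (pref : A → A → Bool) : Set where
  field
    irrefl : ∀ a → nb a ≡ true → pref a a ≡ false
    trans  : ∀ a b c → nb a ≡ true → nb b ≡ true → nb c ≡ true →
             pref a b ≡ true → pref b c ≡ true → pref a c ≡ true
    total  : ∀ a b → nb a ≡ true → nb b ≡ true → a ≢ b →
             (pref a b ≡ true) ⊎ (pref b a ≡ true)

record Instance (G : Graph) : Set where
  field
    prefW  : Fin (nW G) → Fin (nF G) → Fin (nF G) → Bool
    prefF  : Fin (nF G) → Fin (nW G) → Fin (nW G) → Bool
    prefW-order : ∀ w → StrictLinearOn (λ f → adj G w f) (prefW w)
    prefF-order : ∀ f → StrictLinearOn (λ w → adj G w f) (prefF f)
open Instance public

-- A matching: a set of pairwise disjoint edges, represented by the partner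
-- maps of workers and firms, which must be mutually consistent and use edges only.
record Matching (G : Graph) : Set where
  field
    mateW : Fin (nW G) → Maybe (Fin (nF G))
    mateF : Fin (nF G) → Maybe (Fin (nW G))
    consistent : ∀ w f → (mateW w ≡ just f → mateF f ≡ just w)
                       × (mateF f ≡ just w → mateW w ≡ just f)
    edges : ∀ w f → mateW w ≡ just f → adj G w f ≡ true
open Matching public

sumℤ : ∀ {n} → (Fin n → ℤ) → ℤ
sumℤ {n} g = foldr _+_ (+ 0) (map g (allFin n))

sumℕ : ∀ {n} → (Fin n → ℕ) → ℕ
sumℕ {n} g = foldr Data.Nat._+_ 0 (map g (allFin n))

vote : {A : Set} → (A → A → Bool) → Maybe A → Maybe A → ℤ
vote pref (just a) (just b) =
  if pref a b then + 1 else (if pref b a then - (+ 1) else + 0)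
vote pref (just a) nothing  = + 1
vote pref nothing  (just b) = - (+ 1)
vote pref nothing  nothing  = + 0

Δ : {G : Graph} → Instance G → Matching G → Matching G → ℤ
Δ I M M' =
  sumℤ (λ w → vote (prefW I w) (mateW M w) (mateW M' w)) +
  sumℤ (λ f → vote (prefF I f) (mateF M f) (mateF M' f))

-- |M| = number of matched workers (= number of edges)
isJust : {A : Set} → Maybe A → ℕ
isJust (just _) = 1
isJust nothing  = 0

size : {G : Graph} → Matching G → ℕ
size M = sumℕ (λ w → isJust (mateW M w))

Popular : {G : Graph} → Instance G → Matching G → Set
Popular I M = ∀ M' → Δ I M M' ≥ + 0

Dominant : {G : Graph} → Instance G → Matching G → Set
Dominant I M = Popular I M × (∀ M' → size M < size M' → Δ I M M' > + 0)

Unmatched : {G : Graph} → Matching G → Agent G → Set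
Unmatched M (inj₁ w) = mateW M w ≡ nothing
Unmatched M (inj₂ f) = mateF M f ≡ nothing

DifferOnlyAt : {G : Graph} → Instance G → Instance G → Agent G → Set
DifferOnlyAt {G} IA IB x =
  (∀ w → inj₁ w ≢ x → ∀ a b → adj G w a ≡ true → adj G w b ≡ true →
     prefW IA w a b ≡ prefW IB w a b) ×
  (∀ f → inj₂ f ≢ x → ∀ a b → adj G a f ≡ true → adj G b f ≡ true →
     prefF IA f a b ≡ prefF IB f a b)

{-# OPTIONS --safe #-}
-- Δ(M, M') is a sum of individual votes, and an agent's vote consults its
-- preference order only between its partners in M and M', both neighbours.
-- Agents other than x have the same order on neighbours in both instances,
-- and x, being unmatched in M, votes −1 or 0 without consulting its order at
-- all. Hence Δᴬ(M, ·) = Δᴮ(M, ·), and popularity and dominance of M are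
-- defined through Δ(M, ·) alone.
module Submission where

open import Defs
open import Data.Bool using (Bool; true)
open import Data.Fin using (Fin)
open import Data.Fin.Properties using (_≟_)
open import Data.Integer using (ℤ; +_; _+_; _≥_; _>_)
open import Data.List using (map; foldr)
open import Data.List.Base using (allFin)
open import Data.List.Properties using (map-cong)
open import Data.Maybe using (Maybe; just; nothing)
open import Data.Product using (_×_; _,_; proj₁; proj₂)
open import Data.Sum using (inj₁; inj₂)
open import Data.Sum.Properties using (≡-dec)
open import Function.Bundles using (_⇔_; mk⇔)
open import Relation.Binary.PropositionalEquality
open import Relation.Nullary using (yes; no)

sumℤ-cong : ∀ {n} {g h : Fin n → ℤ} → (∀ i → g i ≡ h i) → sumℤ g ≡ sumℤ h
sumℤ-cong {n} g≗h = cong (foldr _+_ (+ 0)) (map-cong g≗h (allFin n))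

vote-unmatched : {A : Set} {p q : A → A → Bool} {m m' : Maybe A} →
                 m ≡ nothing → vote p m m' ≡ vote q m m'
vote-unmatched {m' = just _}  refl = refl
vote-unmatched {m' = nothing} refl = refl

vote-cong-on : {A : Set} (N : A → Bool) {p q : A → A → Bool} {m m' : Maybe A} →
               (∀ a b → N a ≡ true → N b ≡ true → p a b ≡ q a b) →
               (∀ a → m ≡ just a → N a ≡ true) →
               (∀ a → m' ≡ just a → N a ≡ true) →
               vote p m m' ≡ vote q m m'
vote-cong-on N {m = just a} {just b} p≗q Na Nb
  rewrite p≗q a b (Na a refl) (Nb b refl) | p≗q b a (Nb b refl) (Na a refl) = refl
vote-cong-on N {m = just _}  {nothing} _ _ _ = refl
vote-cong-on N {m = nothing} {just _}  _ _ _ = refl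
vote-cong-on N {m = nothing} {nothing} _ _ _ = refl

module _ {G : Graph} where

  mateF-adj : (M : Matching G) → ∀ f w → mateF M f ≡ just w → adj G w f ≡ true
  mateF-adj M f w Mf≡w = edges M w f (proj₂ (consistent M w f) Mf≡w)

  voteAt : Instance G → Matching G → Matching G → Agent G → ℤ
  voteAt I M M' (inj₁ w) = vote (prefW I w) (mateW M w) (mateW M' w)
  voteAt I M M' (inj₂ f) = vote (prefF I f) (mateF M f) (mateF M' f)

  Δ-as-sum : (I : Instance G) (M M' : Matching G) →
             Δ I M M' ≡ sumℤ (λ w → voteAt I M M' (inj₁ w)) + sumℤ (λ f → voteAt I M M' (inj₂ f))
  Δ-as-sum I M M' = refl

  module _ (IA IB : Instance G) (M : Matching G) where

    voteAt-unmatched : ∀ M' z → Unmatched M z → voteAt IA M M' z ≡ voteAt IB M M' z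
    voteAt-unmatched M' (inj₁ w) Mw≡nothing = vote-unmatched Mw≡nothing
    voteAt-unmatched M' (inj₂ f) Mf≡nothing = vote-unmatched Mf≡nothing

    voteAt-differOnlyAt : ∀ {x} → DifferOnlyAt IA IB x →
                          ∀ M' z → z ≢ x → voteAt IA M M' z ≡ voteAt IB M M' z
    voteAt-differOnlyAt D M' (inj₁ w) w≢x =
      vote-cong-on (adj G w) (proj₁ D w w≢x) (edges M w) (edges M' w)
    voteAt-differOnlyAt D M' (inj₂ f) f≢x =
      vote-cong-on (λ w → adj G w f) (proj₂ D f f≢x) (mateF-adj M f) (mateF-adj M' f)

    Δ-differOnlyAt-unmatched : ∀ {x} → DifferOnlyAt IA IB x → Unmatched M x →
                               ∀ M' → Δ IA M M' ≡ Δ IB M M'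
    Δ-differOnlyAt-unmatched {x} D Mx≡nothing M' = begin
      Δ IA M M'
        ≡⟨ Δ-as-sum IA M M' ⟩
      sumℤ (λ w → voteAt IA M M' (inj₁ w)) + sumℤ (λ f → voteAt IA M M' (inj₂ f))
        ≡⟨ cong₂ _+_ (sumℤ-cong (λ w → voteAt-eq (inj₁ w)))
                     (sumℤ-cong (λ f → voteAt-eq (inj₂ f))) ⟩
      sumℤ (λ w → voteAt IB M M' (inj₁ w)) + sumℤ (λ f → voteAt IB M M' (inj₂ f))
        ≡⟨ Δ-as-sum IB M M' ⟨
      Δ IB M M' ∎
      where
      open ≡-Reasoning
      voteAt-eq : ∀ z → voteAt IA M M' z ≡ voteAt IB M M' z
      voteAt-eq z with ≡-dec _≟_ _≟_ z x
      ... | yes refl = voteAt-unmatched M' z Mx≡nothing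
      ... | no z≢x   = voteAt-differOnlyAt D M' z z≢x

  module _ (I J : Instance G) (M : Matching G) where

    Popular-transfer : (∀ M' → Δ I M M' ≡ Δ J M M') → Popular I M → Popular J M
    Popular-transfer Δ-eq popular M' = subst (_≥ + 0) (Δ-eq M') (popular M')

    Dominant-transfer : (∀ M' → Δ I M M' ≡ Δ J M M') → Dominant I M → Dominant J M
    Dominant-transfer Δ-eq (popular , wins-larger) =
      Popular-transfer Δ-eq popular ,
      λ M' larger → subst (_> + 0) (Δ-eq M') (wins-larger M' larger)

  Δ-cong⇒Popular⇔×Dominant⇔ : (I J : Instance G) (M : Matching G) → (∀ M' → Δ I M M' ≡ Δ J M M') →
                              (Popular I M ⇔ Popular J M) × (Dominant I M ⇔ Dominant J M)
  Δ-cong⇒Popular⇔×Dominant⇔ I J M Δ-eq =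
    mk⇔ (Popular-transfer I J M Δ-eq) (Popular-transfer J I M Δ-eq⁻¹) ,
    mk⇔ (Dominant-transfer I J M Δ-eq) (Dominant-transfer J I M Δ-eq⁻¹)
    where
    Δ-eq⁻¹ : ∀ M' → Δ J M M' ≡ Δ I M M'
    Δ-eq⁻¹ M' = sym (Δ-eq M')

lemma3 : {G : Graph} (IA IB : Instance G) (x : Agent G) (M : Matching G) →
         DifferOnlyAt IA IB x → Unmatched M x →
         (Popular IA M ⇔ Popular IB M) × (Dominant IA M ⇔ Dominant IB M)
lemma3 IA IB x M D Mx≡nothing =
  Δ-cong⇒Popular⇔×Dominant⇔ IA IB M (Δ-differOnlyAt-unmatched IA IB M D Mx≡nothing)
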